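{- Let $f:\{ -1,1\}^n\to\{ -1,1\}$ be computed by a decision tree $T$ and let $\mathcal{X}\sim\widehat f^2$. Let $\mathcal{P}$ be the randomized protocol defined recursively as follows on input $(T,S)$ with $S\subseteq[n]$: (1) if $S=\emptyset$, output nothing and stop; (2) let $x_i$ be the root variable of $T$, let $T_0$ (the subtree on the edge $x_i=+1$) compute $g$ and $T_1$ (the subtree on the edge $x_i=-1$) compute $h$; (3) output $1$ if $i\in S$ and $0$ otherwise; (4) let $S'=S\setminus\{i\}$; if $S'=\emptyset$, output $\bot$ and stop; (5) otherwise, with probability $\widehat g(S')^2/(\widehat g(S')^2+\widehat h(S')^2)$ output $0$ and run $\mathcal{P}(T_0,S')$, and with the complementary probability $\widehat h(S')^2/(\widehat g(S')^2+\widehat h(S')^2)$ output $1$ and run $\mathcal{P}(T_1,S')$. Then the expected number of characters output by $\mathcal{P}(T,\mathcal{X})$ (over $\mathcal{X}$ and the internal randomness) is at most $4\cdot\mathbf{I}[f]+2\cdot\mathrm{Cov}[T]$.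
   Context: Fourier coefficients are with respect to the uniform distribution; $\mathcal{X}\sim\widehat f^2$ means $\Pr[\mathcal{X}=S]=\widehat f(S)^2$; $\mathbf{I}[f]=\sum_S|S|\widehat f(S)^2$. Decision trees are assumed to query no variable more than once along any root-to-leaf path. For functions $g,h$, $\mathrm{Cov}[g,h]=\mathbb{E}_x[(g(x)-\mathbb{E}g)(h(x)-\mathbb{E}h)]$ under uniform $x$. For an internal node $v$ of $T$, $\mathrm{Cov}[v]=\mathrm{Cov}[g_v,h_v]$ where $g_v,h_v$ are the functions computed by the left ($+1$) and right ($-1$) subtrees of $v$; $d(v)$ is the depth of $v$ (root has depth $0$); and the tree covariance is $\mathrm{Cov}[T]=\sum_{v}\mathrm{Cov}[v]\,2^{ -d(v)}$ over internal nodes $v$ of $T$. -}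

module Defs where

open import Data.Bool using (Bool; true; false; if_then_else_; _∧_; not)
open import Data.Nat using (ℕ; zero; suc)
open import Data.Fin using (Fin)
open import Data.Vec using (Vec; []; _∷_; lookup; _[_]≔_)
open import Data.List using (List; []; _∷_; map; _++_; foldr)
open import Data.Rational using (ℚ; 0ℚ; 1ℚ; _+_; _*_; _-_; -_; _÷_; ≢-nonZero; _/_)
open import Data.Rational.Properties using (_≟_)
open import Data.Integer using (+_)
open import Relation.Nullary using (yes; no)
open import Relation.Binary.PropositionalEquality using (_≡_)

-- Points of {-1,1}^n : true encodes +1, false encodes -1.
Point : ℕ → Set
Point n = Vec Bool n

-- Subsets of [n] : characteristic vectors, true = member.
Subset : ℕ → Set
Subset n = Vec Bool n

sign : Bool → ℚ
sign true  = 1ℚ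
sign false = - 1ℚ

allVecs : (n : ℕ) → List (Vec Bool n)
allVecs zero    = [] ∷ []
allVecs (suc n) = map (true ∷_) (allVecs n) ++ map (false ∷_) (allVecs n)

sumℚ : List ℚ → ℚ
sumℚ = foldr _+_ 0ℚ

half : ℚ
half = + 1 / 2

halfPow : ℕ → ℚ
halfPow zero    = 1ℚ
halfPow (suc n) = half * halfPow n

𝔼 : (n : ℕ) → (Point n → ℚ) → ℚ
𝔼 n φ = sumℚ (map φ (allVecs n)) * halfPow n

BoolFun : ℕ → Set
BoolFun n = Point n → Bool

χ : {n : ℕ} → Subset n → Point n → ℚ
χ []          []       = 1ℚ
χ (true ∷ S)  (b ∷ x)  = sign b * χ S x
χ (false ∷ S) (b ∷ x)  = χ S x

fourier : {n : ℕ} → BoolFun n → Subset n → ℚ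
fourier {n} f S = 𝔼 n (λ x → sign (f x) * χ S x)

sq : ℚ → ℚ
sq q = q * q

card : {n : ℕ} → Subset n → ℕ
card []          = 0
card (true ∷ S)  = suc (card S)
card (false ∷ S) = card S

influence : {n : ℕ} → BoolFun n → ℚ
influence {n} f = sumℚ (map (λ S → (+ card S / 1) * sq (fourier f S)) (allVecs n))

cov : {n : ℕ} → BoolFun n → BoolFun n → ℚ
cov {n} g h = 𝔼 n (λ x → (sign (g x) - 𝔼 n (λ y → sign (g y)))
                       * (sign (h x) - 𝔼 n (λ y → sign (h y))))

data DT (n : ℕ) : Set where
  leaf : Bool → DT n
  node : Fin n → DT n → DT n → DT n

eval : {n : ℕ} → DT n → BoolFun n
eval (leaf b)       x = b
eval (node i t₀ t₁) x = if lookup x i then eval t₀ x else eval t₁ x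

-- No variable queried more than once along a root-to-leaf path.
-- ValidFrom U T : T never queries a variable in U, nor any variable twice.
data ValidFrom {n : ℕ} : Subset n → DT n → Set where
  leafV : ∀ {U b} → ValidFrom U (leaf b)
  nodeV : ∀ {U i t₀ t₁} → lookup U i ≡ false →
          ValidFrom (U [ i ]≔ true) t₀ → ValidFrom (U [ i ]≔ true) t₁ →
          ValidFrom U (node i t₀ t₁)

emptySet : (n : ℕ) → Subset n
emptySet zero    = []
emptySet (suc n) = false ∷ emptySet n

ValidDT : {n : ℕ} → DT n → Set
ValidDT {n} T = ValidFrom (emptySet n) T

-- Tree covariance Cov[T] = Σ_{internal v} Cov[g_v,h_v] 2^{-d(v)};
-- covFrom d T sums over internal nodes of T placed at depth d.
covFrom : {n : ℕ} → ℕ → DT n → ℚ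
covFrom d (leaf b)       = 0ℚ
covFrom d (node i t₀ t₁) =
  cov (eval t₀) (eval t₁) * halfPow d + covFrom (suc d) t₀ + covFrom (suc d) t₁

treeCov : {n : ℕ} → DT n → ℚ
treeCov T = covFrom 0 T

isEmpty : {n : ℕ} → Subset n → Bool
isEmpty []      = true
isEmpty (b ∷ S) = not b ∧ isEmpty S

-- Division with the convention p / 0 = 0 (only used on branches of
-- probability zero).
_÷₀_ : ℚ → ℚ → ℚ
p ÷₀ q with q ≟ 0ℚ
... | yes _  = 0ℚ
... | no q≢0 = _÷_ p q {{≢-nonZero q≢0}}

expLen : {n : ℕ} → DT n → Subset n → ℚ
expLen T S = if isEmpty S then 0ℚ else step T S
  where
  step : {n : ℕ} → DT n → Subset n → ℚ
  -- step (1) is excluded here (S nonempty). A leaf with S ≠ ∅ is never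
  -- reached with positive probability; value irrelevant, set to 0.
  step (leaf b)       S = 0ℚ
  step (node i t₀ t₁) S =
    let S' = S [ i ]≔ false
        a  = sq (fourier (eval t₀) S')
        b  = sq (fourier (eval t₁) S')
    in 1ℚ + (if isEmpty S' then 1ℚ
             else 1ℚ + ((a * expLen t₀ S' + b * expLen t₁ S') ÷₀ (a + b)))

expLenProtocol : {n : ℕ} → DT n → ℚ
expLenProtocol {n} T =
  sumℚ (map (λ S → sq (fourier (eval T) S) * expLen T S) (allVecs n))

module Submission where

-- Write f = eval T for T = node i t₀ t₁, with g = eval t₀, h = eval t₁.  Validity of T
-- makes g and h ignore the variable x_i, so all their Fourier mass sits on sets S ∌ i and
--   f̂(S ∪ {i}) = (ĝ(S) − ĥ(S))/2,   f̂(S) = (ĝ(S) + ĥ(S))/2      (S ∌ i).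
-- Pairing S ∪ {i} with S ∖ {i} in every sum over subsets then gives three recursions:
--   I[f]     = ½ (I[g] + I[h]) + ½ (1 − 𝔼[gh])                    (Parseval, Plancherel)
--   Cov[T]   = 𝔼[gh] − ĝ(∅) ĥ(∅) + ½ (Cov[t₀] + Cov[t₁])
--   EL(T)    ≤ 2 (1 − ĝ(∅) ĥ(∅)) + ½ (EL(t₀) + EL(t₁))
-- where EL is the expected output length of the protocol; the last one comes from a
-- pointwise bound on each pair {S ∪ {i}, S ∖ {i}}, which is an equality unless S ∖ {i} = ∅.
-- Combining them, 4 I[f] + 2 Cov[T] equals the right-hand side of the EL recursion with
-- EL(tⱼ) replaced by 4 I + 2 Cov of the subtree, and the theorem follows by induction on
-- the validity derivation of T.

open import Defs
open import Data.Bool using (Bool; true; false; if_then_else_)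
open import Data.Nat using (ℕ; zero; suc)
open import Data.Fin using (Fin) renaming (zero to fzero; suc to fsuc)
open import Data.Vec using (Vec; []; _∷_; lookup; _[_]≔_)
open import Data.Vec.Properties using (lookup∘update; lookup∘update′; []≔-idempotent)
open import Data.List using (List; []; _∷_; map; _++_)
open import Data.Sum using (inj₁; inj₂)
open import Data.Integer using (+_)
import Data.Integer as ℤ
import Data.Integer.Properties as ℤ
open import Data.Rational
  using (ℚ; 0ℚ; 1ℚ; _≤_; _+_; _*_; _-_; -_; _/_; 1/_; ≢-nonZero; nonNegative; nonPositive; toℚᵘ)
import Data.Rational.Properties as ℚ
import Data.Rational.Unnormalised as ℚᵘ
import Data.Rational.Unnormalised.Properties as ℚᵘ
open import Data.Rational.Solver using (module +-*-Solver)
open import Relation.Nullary using (yes; no)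
open import Relation.Binary.PropositionalEquality

open +-*-Solver using (solve; _:+_; _:*_; _:-_; :-_; _:=_; con)

module _ {A : Set} where

  sum-++ : (φ : A → ℚ) (xs ys : List A) →
           sumℚ (map φ (xs ++ ys)) ≡ sumℚ (map φ xs) + sumℚ (map φ ys)
  sum-++ φ []       ys = sym (ℚ.+-identityˡ _)
  sum-++ φ (x ∷ xs) ys = trans (cong (_+_ (φ x)) (sum-++ φ xs ys)) (sym (ℚ.+-assoc (φ x) _ _))

  sum-map : {B : Set} (φ : B → ℚ) (k : A → B) (xs : List A) →
            sumℚ (map φ (map k xs)) ≡ sumℚ (map (λ x → φ (k x)) xs)
  sum-map φ k []       = refl
  sum-map φ k (x ∷ xs) = cong (_+_ (φ (k x))) (sum-map φ k xs)

  sum-cong : {φ ψ : A → ℚ} → (∀ x → φ x ≡ ψ x) → (xs : List A) →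
             sumℚ (map φ xs) ≡ sumℚ (map ψ xs)
  sum-cong e []       = refl
  sum-cong e (x ∷ xs) = cong₂ _+_ (e x) (sum-cong e xs)

  sum-+ : (φ ψ : A → ℚ) (xs : List A) →
          sumℚ (map (λ x → φ x + ψ x) xs) ≡ sumℚ (map φ xs) + sumℚ (map ψ xs)
  sum-+ φ ψ []       = refl
  sum-+ φ ψ (x ∷ xs) rewrite sum-+ φ ψ xs =
    solve 4 (λ a b c d → (a :+ b) :+ (c :+ d) := (a :+ c) :+ (b :+ d)) refl
      (φ x) (ψ x) (sumℚ (map φ xs)) (sumℚ (map ψ xs))

  sum-* : (c : ℚ) (φ : A → ℚ) (xs : List A) →
          sumℚ (map (λ x → c * φ x) xs) ≡ c * sumℚ (map φ xs)
  sum-* c φ []       = sym (ℚ.*-zeroʳ c)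
  sum-* c φ (x ∷ xs) rewrite sum-* c φ xs = sym (ℚ.*-distribˡ-+ c (φ x) _)

  sum-mono : {φ ψ : A → ℚ} → (∀ x → φ x ≤ ψ x) → (xs : List A) →
             sumℚ (map φ xs) ≤ sumℚ (map ψ xs)
  sum-mono e []       = ℚ.≤-refl
  sum-mono e (x ∷ xs) = ℚ.+-mono-≤ (e x) (sum-mono e xs)

Σ : (n : ℕ) → (Vec Bool n → ℚ) → ℚ
Σ n φ = sumℚ (map φ (allVecs n))

Σ-cong : ∀ n {φ ψ : Vec Bool n → ℚ} → (∀ x → φ x ≡ ψ x) → Σ n φ ≡ Σ n ψ
Σ-cong n e = sum-cong e (allVecs n)

Σ-+ : ∀ n (φ ψ : Vec Bool n → ℚ) → Σ n (λ x → φ x + ψ x) ≡ Σ n φ + Σ n ψ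
Σ-+ n φ ψ = sum-+ φ ψ (allVecs n)

Σ-* : ∀ n c (φ : Vec Bool n → ℚ) → Σ n (λ x → c * φ x) ≡ c * Σ n φ
Σ-* n c φ = sum-* c φ (allVecs n)

Σ-linear : ∀ n c d (φ ψ : Vec Bool n → ℚ) →
           Σ n (λ x → c * φ x + d * ψ x) ≡ c * Σ n φ + d * Σ n ψ
Σ-linear n c d φ ψ = trans (Σ-+ n _ _) (cong₂ _+_ (Σ-* n c φ) (Σ-* n d ψ))

Σ-mono : ∀ n {φ ψ : Vec Bool n → ℚ} → (∀ x → φ x ≤ ψ x) → Σ n φ ≤ Σ n ψ
Σ-mono n e = sum-mono e (allVecs n)

Σ-zero : ∀ n → Σ n (λ _ → 0ℚ) ≡ 0ℚ
Σ-zero n = trans (Σ-* n 0ℚ (λ _ → 0ℚ)) (ℚ.*-zeroˡ (Σ n (λ _ → 0ℚ)))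

Σ-nonneg : ∀ n {φ : Vec Bool n → ℚ} → (∀ x → 0ℚ ≤ φ x) → 0ℚ ≤ Σ n φ
Σ-nonneg n e = subst (_≤ Σ n _) (Σ-zero n) (Σ-mono n e)

Σ-suc : ∀ n (φ : Vec Bool (suc n) → ℚ) →
        Σ (suc n) φ ≡ Σ n (λ x → φ (true ∷ x)) + Σ n (λ x → φ (false ∷ x))
Σ-suc n φ = trans (sum-++ φ (map (true ∷_) (allVecs n)) _)
                  (cong₂ _+_ (sum-map φ (true ∷_) (allVecs n)) (sum-map φ (false ∷_) (allVecs n)))

-- Splitting at an arbitrary coordinate i: every x is hit exactly twice by the pairs
-- (x [ i ]≔ true, x [ i ]≔ false), hence the factor ½.
Σ-split : ∀ {n} (i : Fin n) (φ : Vec Bool n → ℚ) →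
          Σ n φ ≡ half * Σ n (λ x → φ (x [ i ]≔ true) + φ (x [ i ]≔ false))
Σ-split {suc n} fzero φ = begin
    Σ (suc n) φ                       ≡⟨ Σ-suc n φ ⟩
    A + B                             ≡⟨ solve 2 (λ a b → a :+ b := con half :* ((a :+ b) :+ (a :+ b))) refl A B ⟩
    half * ((A + B) + (A + B))        ≡⟨ cong (half *_) (sym (cong₂ _+_ (Σ-+ n _ _) (Σ-+ n _ _))) ⟩
    half * (Σ n pair + Σ n pair)      ≡⟨ cong (half *_) (sym (Σ-suc n _)) ⟩
    half * Σ (suc n) (λ x → φ (x [ fzero ]≔ true) + φ (x [ fzero ]≔ false)) ∎
  where
  open ≡-Reasoning
  A = Σ n (λ x → φ (true ∷ x))
  B = Σ n (λ x → φ (false ∷ x))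
  pair = λ x → φ (true ∷ x) + φ (false ∷ x)
Σ-split {suc n} (fsuc i) φ = begin
    Σ (suc n) φ                                   ≡⟨ Σ-suc n φ ⟩
    Σ n (λ x → φ (true ∷ x)) + Σ n (λ x → φ (false ∷ x))
      ≡⟨ cong₂ _+_ (Σ-split i (λ x → φ (true ∷ x))) (Σ-split i (λ x → φ (false ∷ x))) ⟩
    half * A + half * B                           ≡⟨ sym (ℚ.*-distribˡ-+ half A B) ⟩
    half * (A + B)                                ≡⟨ cong (half *_) (sym (Σ-suc n _)) ⟩
    half * Σ (suc n) (λ x → φ (x [ fsuc i ]≔ true) + φ (x [ fsuc i ]≔ false)) ∎
  where
  open ≡-Reasoning
  A = Σ n (λ x → φ (true ∷ (x [ i ]≔ true)) + φ (true ∷ (x [ i ]≔ false)))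
  B = Σ n (λ x → φ (false ∷ (x [ i ]≔ true)) + φ (false ∷ (x [ i ]≔ false)))

Σ-fold : ∀ {n} (i : Fin n) (ψ : Vec Bool n → ℚ) → (∀ S → ψ (S [ i ]≔ true) ≡ 0ℚ) →
         half * Σ n (λ S → ψ (S [ i ]≔ false)) ≡ Σ n ψ
Σ-fold {n} i ψ vanish = sym (trans (Σ-split i ψ) (cong (half *_)
  (Σ-cong n (λ S → trans (cong (_+ ψ (S [ i ]≔ false)) (vanish S)) (ℚ.+-identityˡ _)))))

Σ-at-empty : ∀ n (K : Subset n → ℚ) →
             Σ n (λ S → if isEmpty S then K S else 0ℚ) ≡ K (emptySet n)
Σ-at-empty zero    K = ℚ.+-identityʳ _
Σ-at-empty (suc n) K = trans (Σ-suc n _)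
  (trans (cong₂ _+_ (Σ-zero n) (Σ-at-empty n (λ S → K (false ∷ S)))) (ℚ.+-identityˡ _))

𝔼-cong : ∀ n {φ ψ : Point n → ℚ} → (∀ x → φ x ≡ ψ x) → 𝔼 n φ ≡ 𝔼 n ψ
𝔼-cong n e = cong (_* halfPow n) (Σ-cong n e)

𝔼-+ : ∀ n (φ ψ : Point n → ℚ) → 𝔼 n (λ x → φ x + ψ x) ≡ 𝔼 n φ + 𝔼 n ψ
𝔼-+ n φ ψ = trans (cong (_* halfPow n) (Σ-+ n φ ψ)) (ℚ.*-distribʳ-+ (halfPow n) (Σ n φ) (Σ n ψ))

𝔼-* : ∀ n c (φ : Point n → ℚ) → 𝔼 n (λ x → c * φ x) ≡ c * 𝔼 n φ
𝔼-* n c φ = trans (cong (_* halfPow n) (Σ-* n c φ)) (ℚ.*-assoc c _ _)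

𝔼-pull : ∀ n c (φ ψ : Point n → ℚ) → 𝔼 n (λ x → φ x * (c * ψ x)) ≡ c * 𝔼 n (λ x → φ x * ψ x)
𝔼-pull n c φ ψ = trans (𝔼-cong n (λ x → solve 3 (λ p c q → p :* (c :* q) := c :* (p :* q)) refl (φ x) c (ψ x)))
                       (𝔼-* n c (λ x → φ x * ψ x))

𝔼-suc : ∀ n (φ : Point (suc n) → ℚ) →
        𝔼 (suc n) φ ≡ half * (𝔼 n (λ x → φ (true ∷ x)) + 𝔼 n (λ x → φ (false ∷ x)))
𝔼-suc n φ = trans (cong (_* halfPow (suc n)) (Σ-suc n φ))
  (solve 4 (λ a b h k → (a :+ b) :* (h :* k) := h :* (a :* k :+ b :* k)) refl
    (Σ n (λ x → φ (true ∷ x))) (Σ n (λ x → φ (false ∷ x))) half (halfPow n))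

𝔼-const : ∀ n c → 𝔼 n (λ _ → c) ≡ c
𝔼-const zero    c = solve 1 (λ c → (c :+ con 0ℚ) :* con 1ℚ := c) refl c
𝔼-const (suc n) c = trans (𝔼-suc n _) (trans (cong (λ z → half * (z + z)) (𝔼-const n c))
                          (solve 1 (λ c → con half :* (c :+ c) := c) refl c))

𝔼-split : ∀ {n} (i : Fin n) (φ : Point n → ℚ) →
          𝔼 n φ ≡ half * (𝔼 n (λ x → φ (x [ i ]≔ true)) + 𝔼 n (λ x → φ (x [ i ]≔ false)))
𝔼-split {n} i φ = trans (cong (_* halfPow n) (trans (Σ-split i φ) (cong (half *_) (Σ-+ n _ _))))
  (solve 4 (λ h a b k → h :* (a :+ b) :* k := h :* (a :* k :+ b :* k)) refl
    half (Σ n (λ x → φ (x [ i ]≔ true))) (Σ n (λ x → φ (x [ i ]≔ false))) (halfPow n))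

𝔼-centred-product : ∀ n (φ ψ : Point n → ℚ) →
  𝔼 n (λ x → (φ x - 𝔼 n φ) * (ψ x - 𝔼 n ψ)) ≡ 𝔼 n (λ x → φ x * ψ x) - 𝔼 n φ * 𝔼 n ψ
𝔼-centred-product n φ ψ = begin
    𝔼 n (λ x → (φ x - μ) * (ψ x - ν))
      ≡⟨ 𝔼-cong n (λ x → solve 4 (λ p q m k → (p :- m) :* (q :- k)
                                    := p :* q :+ ((:- k) :* p :+ ((:- m) :* q :+ m :* k))) refl (φ x) (ψ x) μ ν) ⟩
    𝔼 n (λ x → φ x * ψ x + ((- ν) * φ x + ((- μ) * ψ x + μ * ν)))
      ≡⟨ trans (𝔼-+ n _ _) (cong (_+_ (𝔼 n (λ x → φ x * ψ x))) (trans (𝔼-+ n _ _)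
           (cong₂ _+_ (𝔼-* n (- ν) φ) (trans (𝔼-+ n _ _) (cong₂ _+_ (𝔼-* n (- μ) ψ) (𝔼-const n (μ * ν))))))) ⟩
    𝔼 n (λ x → φ x * ψ x) + ((- ν) * μ + ((- μ) * ν + μ * ν))
      ≡⟨ solve 3 (λ e m k → e :+ ((:- k) :* m :+ ((:- m) :* k :+ m :* k)) := e :- m :* k) refl
           (𝔼 n (λ x → φ x * ψ x)) μ ν ⟩
    𝔼 n (λ x → φ x * ψ x) - μ * ν ∎
  where
  open ≡-Reasoning
  μ = 𝔼 n φ
  ν = 𝔼 n ψ

F̂ : {n : ℕ} → (Point n → ℚ) → Subset n → ℚ
F̂ {n} φ S = 𝔼 n (λ x → φ x * χ S x)

F̂-cong : ∀ {n} {φ ψ : Point n → ℚ} → (∀ x → φ x ≡ ψ x) → ∀ S → F̂ φ S ≡ F̂ ψ S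
F̂-cong {n} e S = 𝔼-cong n (λ x → cong (_* χ S x) (e x))

F̂-empty : ∀ {n} (φ : Point n → ℚ) → F̂ φ (emptySet n) ≡ 𝔼 n φ
F̂-empty {n} φ = 𝔼-cong n (λ x → trans (cong (φ x *_) (χ-empty x)) (ℚ.*-identityʳ (φ x)))
  where
  χ-empty : ∀ {m} (x : Point m) → χ (emptySet m) x ≡ 1ℚ
  χ-empty []      = refl
  χ-empty (b ∷ x) = χ-empty x

-- Splitting off the first coordinate: the first character factor is x₀ or 1.
F̂-cons-true : ∀ n (φ : Point (suc n) → ℚ) S →
  F̂ φ (true ∷ S) ≡ half * (F̂ (λ x → φ (true ∷ x)) S - F̂ (λ x → φ (false ∷ x)) S)
F̂-cons-true n φ S = trans (𝔼-suc n _)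
  (trans (cong (λ z → half * z) (cong₂ _+_ (𝔼-pull n 1ℚ (λ x → φ (true ∷ x)) (χ S))
                                           (𝔼-pull n (- 1ℚ) (λ x → φ (false ∷ x)) (χ S))))
    (solve 2 (λ a b → con half :* (con 1ℚ :* a :+ con (- 1ℚ) :* b) := con half :* (a :- b)) refl
      (F̂ (λ x → φ (true ∷ x)) S) (F̂ (λ x → φ (false ∷ x)) S)))

F̂-cons-false : ∀ n (φ : Point (suc n) → ℚ) S →
  F̂ φ (false ∷ S) ≡ half * (F̂ (λ x → φ (true ∷ x)) S + F̂ (λ x → φ (false ∷ x)) S)
F̂-cons-false n φ S = 𝔼-suc n _

plancherel : ∀ n (φ ψ : Point n → ℚ) → Σ n (λ S → F̂ φ S * F̂ ψ S) ≡ 𝔼 n (λ x → φ x * ψ x)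
plancherel zero φ ψ =
  solve 2 (λ p q → ((p :* con 1ℚ :+ con 0ℚ) :* con 1ℚ) :* ((q :* con 1ℚ :+ con 0ℚ) :* con 1ℚ) :+ con 0ℚ
                   := (p :* q :+ con 0ℚ) :* con 1ℚ) refl (φ []) (ψ [])
plancherel (suc n) φ ψ = begin
    Σ (suc n) (λ S → F̂ φ S * F̂ ψ S)
      ≡⟨ trans (Σ-suc n _) (sym (Σ-+ n _ _)) ⟩
    Σ n (λ S → F̂ φ (true ∷ S) * F̂ ψ (true ∷ S) + F̂ φ (false ∷ S) * F̂ ψ (false ∷ S))
      ≡⟨ Σ-cong n faces ⟩
    Σ n (λ S → half * (F̂ φ₁ S * F̂ ψ₁ S) + half * (F̂ φ₀ S * F̂ ψ₀ S))
      ≡⟨ Σ-linear n half half _ _ ⟩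
    half * Σ n (λ S → F̂ φ₁ S * F̂ ψ₁ S) + half * Σ n (λ S → F̂ φ₀ S * F̂ ψ₀ S)
      ≡⟨ cong₂ (λ u v → half * u + half * v) (plancherel n φ₁ ψ₁) (plancherel n φ₀ ψ₀) ⟩
    half * 𝔼 n (λ x → φ₁ x * ψ₁ x) + half * 𝔼 n (λ x → φ₀ x * ψ₀ x)
      ≡⟨ sym (trans (𝔼-suc n (λ x → φ x * ψ x))
                    (ℚ.*-distribˡ-+ half (𝔼 n (λ x → φ₁ x * ψ₁ x)) (𝔼 n (λ x → φ₀ x * ψ₀ x)))) ⟩
    𝔼 (suc n) (λ x → φ x * ψ x) ∎
  where
  open ≡-Reasoning
  φ₁ φ₀ ψ₁ ψ₀ : Point n → ℚ
  φ₁ x = φ (true ∷ x)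
  φ₀ x = φ (false ∷ x)
  ψ₁ x = ψ (true ∷ x)
  ψ₀ x = ψ (false ∷ x)
  faces : ∀ S → F̂ φ (true ∷ S) * F̂ ψ (true ∷ S) + F̂ φ (false ∷ S) * F̂ ψ (false ∷ S)
              ≡ half * (F̂ φ₁ S * F̂ ψ₁ S) + half * (F̂ φ₀ S * F̂ ψ₀ S)
  faces S = trans
    (cong₂ _+_ (cong₂ _*_ (F̂-cons-true n φ S) (F̂-cons-true n ψ S))
               (cong₂ _*_ (F̂-cons-false n φ S) (F̂-cons-false n ψ S)))
    (solve 4 (λ a b c d → (con half :* (a :- b)) :* (con half :* (c :- d))
                          :+ (con half :* (a :+ b)) :* (con half :* (c :+ d))
                          := con half :* (a :* c) :+ con half :* (b :* d)) refl
      (F̂ φ₁ S) (F̂ φ₀ S) (F̂ ψ₁ S) (F̂ ψ₀ S))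

parseval : ∀ {n} (f : BoolFun n) → Σ n (λ S → sq (fourier f S)) ≡ 1ℚ
parseval {n} f = trans (plancherel n (λ x → sign (f x)) (λ x → sign (f x)))
                       (trans (𝔼-cong n (λ x → sign² (f x))) (𝔼-const n 1ℚ))
  where
  sign² : ∀ b → sign b * sign b ≡ 1ℚ
  sign² true  = refl
  sign² false = refl

cov-expand : ∀ {n} (g h : BoolFun n) →
  cov g h ≡ 𝔼 n (λ x → sign (g x) * sign (h x)) - fourier g (emptySet n) * fourier h (emptySet n)
cov-expand {n} g h = trans (𝔼-centred-product n (λ x → sign (g x)) (λ x → sign (h x)))
  (cong (λ z → 𝔼 n (λ x → sign (g x) * sign (h x)) - z)
    (sym (cong₂ _*_ (F̂-empty (λ x → sign (g x))) (F̂-empty (λ x → sign (h x))))))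

Ignores : ∀ {n} {B : Set} → Fin n → (Point n → B) → Set
Ignores i φ = ∀ x v → φ (x [ i ]≔ v) ≡ φ x

χ-add : ∀ {n} (S : Subset n) (x : Point n) (i : Fin n) (v : Bool) →
        χ (S [ i ]≔ true) (x [ i ]≔ v) ≡ sign v * χ (S [ i ]≔ false) x
χ-add (s ∷ S)     (b ∷ x) fzero    v = refl
χ-add (true ∷ S)  (b ∷ x) (fsuc i) v = trans (cong (sign b *_) (χ-add S x i v))
  (solve 3 (λ a c d → a :* (c :* d) := c :* (a :* d)) refl (sign b) (sign v) (χ (S [ i ]≔ false) x))
χ-add (false ∷ S) (b ∷ x) (fsuc i) v = χ-add S x i v

χ-drop : ∀ {n} (S : Subset n) (x : Point n) (i : Fin n) (v : Bool) →
         χ (S [ i ]≔ false) (x [ i ]≔ v) ≡ χ (S [ i ]≔ false) x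
χ-drop (s ∷ S)     (b ∷ x) fzero    v = refl
χ-drop (true ∷ S)  (b ∷ x) (fsuc i) v = cong (sign b *_) (χ-drop S x i v)
χ-drop (false ∷ S) (b ∷ x) (fsuc i) v = χ-drop S x i v

F̂-split-at : ∀ {n} (i : Fin n) (φ : Point n → ℚ) (Z Z′ : Subset n) (c : Bool → ℚ) →
  (∀ x v → χ Z (x [ i ]≔ v) ≡ c v * χ Z′ x) →
  F̂ φ Z ≡ half * (c true * F̂ (λ x → φ (x [ i ]≔ true)) Z′ + c false * F̂ (λ x → φ (x [ i ]≔ false)) Z′)
F̂-split-at {n} i φ Z Z′ c χ-fixed =
  trans (𝔼-split i _) (cong (half *_) (cong₂ _+_ (restrict true) (restrict false)))
  where
  restrict : ∀ v → 𝔼 n (λ x → φ (x [ i ]≔ v) * χ Z (x [ i ]≔ v)) ≡ c v * F̂ (λ x → φ (x [ i ]≔ v)) Z′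
  restrict v = trans (𝔼-cong n (λ x → cong (φ (x [ i ]≔ v) *_) (χ-fixed x v)))
                     (𝔼-pull n (c v) (λ x → φ (x [ i ]≔ v)) (χ Z′))

F̂-add : ∀ {n} (i : Fin n) (φ : Point n → ℚ) (S : Subset n) →
  F̂ φ (S [ i ]≔ true)
    ≡ half * (F̂ (λ x → φ (x [ i ]≔ true)) (S [ i ]≔ false) - F̂ (λ x → φ (x [ i ]≔ false)) (S [ i ]≔ false))
F̂-add i φ S = trans (F̂-split-at i φ (S [ i ]≔ true) (S [ i ]≔ false) sign (λ x v → χ-add S x i v))
  (solve 2 (λ a b → con half :* (con 1ℚ :* a :+ con (- 1ℚ) :* b) := con half :* (a :- b)) refl
    (F̂ (λ x → φ (x [ i ]≔ true)) (S [ i ]≔ false)) (F̂ (λ x → φ (x [ i ]≔ false)) (S [ i ]≔ false)))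

F̂-drop : ∀ {n} (i : Fin n) (φ : Point n → ℚ) (S : Subset n) →
  F̂ φ (S [ i ]≔ false)
    ≡ half * (F̂ (λ x → φ (x [ i ]≔ true)) (S [ i ]≔ false) + F̂ (λ x → φ (x [ i ]≔ false)) (S [ i ]≔ false))
F̂-drop i φ S =
  trans (F̂-split-at i φ S′ S′ (λ _ → 1ℚ) (λ x v → trans (χ-drop S x i v) (sym (ℚ.*-identityˡ (χ S′ x)))))
        (cong (half *_) (cong₂ _+_ (ℚ.*-identityˡ (F̂ (λ x → φ (x [ i ]≔ true)) S′))
                                   (ℚ.*-identityˡ (F̂ (λ x → φ (x [ i ]≔ false)) S′))))
  where S′ = S [ i ]≔ false

F̂-ignoring : ∀ {n} (i : Fin n) (φ : Point n → ℚ) → Ignores i φ → ∀ S → F̂ φ (S [ i ]≔ true) ≡ 0ℚ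
F̂-ignoring i φ ign S = trans (F̂-add i φ S)
  (trans (cong₂ (λ u v → half * (u - v)) (F̂-cong (λ x → ign x true) (S [ i ]≔ false))
                                          (F̂-cong (λ x → ign x false) (S [ i ]≔ false)))
         (solve 1 (λ a → con half :* (a :- a) := con 0ℚ) refl (F̂ φ (S [ i ]≔ false))))

ignores-used : ∀ {n U} {T : DT n} → ValidFrom U T → ∀ {j} → lookup U j ≡ true → Ignores j (eval T)
ignores-used leafV Uj x v = refl
ignores-used {U = U} (nodeV {i = k} {t₀} {t₁} Uk v₀ v₁) {j} Uj x v =
  trans (cong (λ b → if b then eval t₀ (x [ j ]≔ v) else eval t₁ (x [ j ]≔ v))
              (lookup∘update′ k≢j x v))
        (cong₂ (λ a b → if lookup x k then a else b) (ignores-used v₀ Uj′ x v) (ignores-used v₁ Uj′ x v))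
  where
  k≢j : k ≢ j
  k≢j refl with trans (sym Uk) Uj
  ... | ()
  Uj′ : lookup (U [ k ]≔ true) j ≡ true
  Uj′ = trans (lookup∘update′ (λ j≡k → k≢j (sym j≡k)) U true) Uj

covFrom-suc : ∀ {n} d (T : DT n) → covFrom (suc d) T ≡ half * covFrom d T
covFrom-suc d (leaf b)       = sym (ℚ.*-zeroʳ half)
covFrom-suc d (node i t₀ t₁) rewrite covFrom-suc (suc d) t₀ | covFrom-suc (suc d) t₁ =
  solve 4 (λ c h p q → c :* (con half :* h) :+ con half :* p :+ con half :* q
                       := con half :* (c :* h :+ p :+ q)) refl
    (cov (eval t₀) (eval t₁)) (halfPow d) (covFrom (suc d) t₀) (covFrom (suc d) t₁)

treeCov-node : ∀ {n} (i : Fin n) (t₀ t₁ : DT n) →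
  treeCov (node i t₀ t₁) ≡ cov (eval t₀) (eval t₁) + half * (treeCov t₀ + treeCov t₁)
treeCov-node i t₀ t₁ = trans (cong₂ (λ p q → cov (eval t₀) (eval t₁) * 1ℚ + p + q) (covFrom-suc 0 t₀) (covFrom-suc 0 t₁))
  (solve 3 (λ c p q → c :* con 1ℚ :+ con half :* p :+ con half :* q := c :+ con half :* (p :+ q)) refl
    (cov (eval t₀) (eval t₁)) (treeCov t₀) (treeCov t₁))

isEmpty-add : ∀ {n} (S : Subset n) (i : Fin n) → isEmpty (S [ i ]≔ true) ≡ false
isEmpty-add (s ∷ S)     fzero    = refl
isEmpty-add (true ∷ S)  (fsuc i) = refl
isEmpty-add (false ∷ S) (fsuc i) = isEmpty-add S i

card-add : ∀ {n} (S : Subset n) (i : Fin n) → card (S [ i ]≔ true) ≡ suc (card (S [ i ]≔ false))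
card-add (s ∷ S)     fzero    = refl
card-add (true ∷ S)  (fsuc i) = cong suc (card-add S i)
card-add (false ∷ S) (fsuc i) = card-add S i

fromℕ : ℕ → ℚ
fromℕ k = + k / 1

fromℕ-suc : ∀ k → fromℕ (suc k) ≡ 1ℚ + fromℕ k
fromℕ-suc k = ℚ.toℚᵘ-injective (begin
    toℚᵘ (fromℕ (suc k))              ≈⟨ ℚ.toℚᵘ-fromℚᵘ (ℚᵘ.mkℚᵘ (+ suc k) 0) ⟩
    ℚᵘ.mkℚᵘ (+ suc k) 0               ≈⟨ ℚᵘ.*≡* suc≡1+ ⟩
    ℚᵘ.1ℚᵘ ℚᵘ.+ ℚᵘ.mkℚᵘ (+ k) 0       ≈⟨ ℚᵘ.+-congʳ ℚᵘ.1ℚᵘ (ℚᵘ.≃-sym (ℚ.toℚᵘ-fromℚᵘ (ℚᵘ.mkℚᵘ (+ k) 0))) ⟩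
    toℚᵘ 1ℚ ℚᵘ.+ toℚᵘ (fromℕ k)       ≈⟨ ℚᵘ.≃-sym (ℚ.toℚᵘ-homo-+ 1ℚ (fromℕ k)) ⟩
    toℚᵘ (1ℚ + fromℕ k)               ∎)
  where
  open ℚᵘ.≃-Reasoning
  suc≡1+ : + suc k ℤ.* + 1 ≡ (+ 1 ℤ.+ + k ℤ.* + 1) ℤ.* + 1
  suc≡1+ = trans (ℤ.*-identityʳ (+ suc k))
                 (sym (trans (ℤ.*-identityʳ _) (cong (ℤ._+_ (+ 1)) (ℤ.*-identityʳ (+ k)))))

fromℕ-nonneg : ∀ k → 0ℚ ≤ fromℕ k
fromℕ-nonneg k = ℚ.nonNegative⁻¹ (+ k / 1) {{ℚ.normalize-nonNeg k 1}}

*-nonneg : ∀ {p q} → 0ℚ ≤ p → 0ℚ ≤ q → 0ℚ ≤ p * q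
*-nonneg {p} {q} 0≤p 0≤q = ℚ.nonNegative⁻¹ (p * q) {{ℚ.nonNeg*nonNeg⇒nonNeg p {{nonNegative 0≤p}} q {{nonNegative 0≤q}}}}

sq-nonneg : ∀ p → 0ℚ ≤ sq p
sq-nonneg p with ℚ.≤-total 0ℚ p
... | inj₁ 0≤p = *-nonneg 0≤p 0≤p
... | inj₂ p≤0 = ℚ.nonNegative⁻¹ (p * p) {{ℚ.nonPos*nonPos⇒nonPos p {{nonPositive p≤0}} p {{nonPositive p≤0}}}}

influenceTerm : ∀ {n} → BoolFun n → Subset n → ℚ
influenceTerm f S = fromℕ (card S) * sq (fourier f S)

influence-nonneg : ∀ {n} (f : BoolFun n) → 0ℚ ≤ influence f
influence-nonneg {n} f = Σ-nonneg n (λ S → *-nonneg (fromℕ-nonneg (card S)) (sq-nonneg (fourier f S)))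

weighted-average : ∀ p q x y → 0ℚ ≤ p → 0ℚ ≤ q →
                   (p + q) * ((p * x + q * y) ÷₀ (p + q)) ≡ p * x + q * y
weighted-average p q x y 0≤p 0≤q with (p + q) ℚ.≟ 0ℚ
... | yes p+q≡0 = begin
    (p + q) * 0ℚ      ≡⟨ ℚ.*-zeroʳ (p + q) ⟩
    0ℚ                ≡⟨ solve 2 (λ x y → con 0ℚ := con 0ℚ :* x :+ con 0ℚ :* y) refl x y ⟩
    0ℚ * x + 0ℚ * y   ≡⟨ cong₂ (λ u v → u * x + v * y) (sym (vanishes 0≤p 0≤q p+q≡0))
                                (sym (vanishes 0≤q 0≤p (trans (ℚ.+-comm q p) p+q≡0))) ⟩
    p * x + q * y     ∎
  where
  open ≡-Reasoning
  vanishes : ∀ {a b} → 0ℚ ≤ a → 0ℚ ≤ b → a + b ≡ 0ℚ → a ≡ 0ℚ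
  vanishes {a} {b} 0≤a 0≤b a+b≡0 = ℚ.≤-antisym
    (ℚ.≤-trans (subst (_≤ a + b) (ℚ.+-identityʳ a) (ℚ.+-monoʳ-≤ a 0≤b)) (ℚ.≤-reflexive a+b≡0)) 0≤a
... | no p+q≢0 = begin
    (p + q) * (X * 1/ (p + q))   ≡⟨ solve 3 (λ s X r → s :* (X :* r) := X :* (s :* r)) refl (p + q) X (1/ (p + q)) ⟩
    X * ((p + q) * 1/ (p + q))   ≡⟨ cong (X *_) (ℚ.*-inverseʳ (p + q)) ⟩
    X * 1ℚ                       ≡⟨ ℚ.*-identityʳ X ⟩
    X                            ∎
  where
  open ≡-Reasoning
  instance _ = ≢-nonZero p+q≢0
  X = p * x + q * y

two four : ℚ
two  = + 2 / 1
four = + 4 / 1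

expLen-empty : ∀ {n} (t : DT n) (Z : Subset n) → isEmpty Z ≡ true → expLen t Z ≡ 0ℚ
expLen-empty t Z empty rewrite empty = refl

-- The protocol's cost on the pair {S ∪ {i}, S ∖ {i}} at a node, in terms of the subtree
-- coefficients a = ĝ(S ∖ {i}), b = ĥ(S ∖ {i}), the subtree costs e₀, e₁ on S ∖ {i} and
-- their weighted average r: it is an equality unless S ∖ {i} = ∅, where half of the
-- weight (a − b)² is lost.
pair-cost-bound : ∀ (empty : Bool) (a b r e₀ e₁ : ℚ) →
  (empty ≡ true → e₀ ≡ 0ℚ) → (empty ≡ true → e₁ ≡ 0ℚ) →
  (sq a + sq b) * r ≡ sq a * e₀ + sq b * e₁ →
  sq (half * (a - b)) * (1ℚ + (if empty then 1ℚ else 1ℚ + r))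
    + sq (half * (a + b)) * (if empty then 0ℚ else 1ℚ + (1ℚ + r))
  ≤ (sq a + sq b) + ((- two) * (if empty then a * b else 0ℚ) + half * (sq a * e₀ + sq b * e₁))
pair-cost-bound true a b r e₀ e₁ e₀≡0 e₁≡0 _ rewrite e₀≡0 refl | e₁≡0 refl = begin
    cost                     ≤⟨ subst (_≤ cost + (d + d)) (ℚ.+-identityʳ cost)
                                      (ℚ.+-monoʳ-≤ cost (ℚ.+-mono-≤ (sq-nonneg (half * (a - b))) (sq-nonneg (half * (a - b))))) ⟩
    cost + (d + d)           ≡⟨ solve 2 (λ a b →
                                  (con half :* (a :- b)) :* (con half :* (a :- b)) :* (con 1ℚ :+ con 1ℚ)
                                    :+ (con half :* (a :+ b)) :* (con half :* (a :+ b)) :* con 0ℚ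
                                    :+ ((con half :* (a :- b)) :* (con half :* (a :- b)) :+ (con half :* (a :- b)) :* (con half :* (a :- b)))
                                  := (a :* a :+ b :* b) :+ (con (- two) :* (a :* b) :+ con half :* (a :* a :* con 0ℚ :+ b :* b :* con 0ℚ)))
                                  refl a b ⟩
    (sq a + sq b) + ((- two) * (a * b) + half * (sq a * 0ℚ + sq b * 0ℚ)) ∎
  where
  open ℚ.≤-Reasoning
  d = sq (half * (a - b))
  cost = sq (half * (a - b)) * (1ℚ + 1ℚ) + sq (half * (a + b)) * 0ℚ
pair-cost-bound false a b r e₀ e₁ _ _ average = ℚ.≤-reflexive (begin
    sq (half * (a - b)) * (1ℚ + (1ℚ + r)) + sq (half * (a + b)) * (1ℚ + (1ℚ + r))
      ≡⟨ solve 3 (λ a b r → (con half :* (a :- b)) :* (con half :* (a :- b)) :* (con 1ℚ :+ (con 1ℚ :+ r))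
                            :+ (con half :* (a :+ b)) :* (con half :* (a :+ b)) :* (con 1ℚ :+ (con 1ℚ :+ r))
                            := (a :* a :+ b :* b) :+ (con (- two) :* con 0ℚ :+ con half :* ((a :* a :+ b :* b) :* r)))
                 refl a b r ⟩
    (sq a + sq b) + ((- two) * 0ℚ + half * ((sq a + sq b) * r))
      ≡⟨ cong (λ z → (sq a + sq b) + ((- two) * 0ℚ + half * z)) average ⟩
    (sq a + sq b) + ((- two) * 0ℚ + half * (sq a * e₀ + sq b * e₁)) ∎)
  where open ≡-Reasoning

lengthBound : ∀ {n} → DT n → ℚ
lengthBound T = four * influence (eval T) + two * treeCov T

module Node {n : ℕ} (i : Fin n) (t₀ t₁ : DT n)
            (ign₀ : Ignores i (eval t₀)) (ign₁ : Ignores i (eval t₁)) where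

  T : DT n
  T = node i t₀ t₁

  f g h : BoolFun n
  f = eval T
  g = eval t₀
  h = eval t₁

  add drop : Subset n → Subset n
  add S  = S [ i ]≔ true
  drop S = S [ i ]≔ false

  ĝ ĥ : Subset n → ℚ
  ĝ = fourier g
  ĥ = fourier h

  f-true : ∀ x → f (x [ i ]≔ true) ≡ g x
  f-true x = trans (cong (λ c → if c then g (x [ i ]≔ true) else h (x [ i ]≔ true)) (lookup∘update i x true))
                   (ign₀ x true)

  f-false : ∀ x → f (x [ i ]≔ false) ≡ h x
  f-false x = trans (cong (λ c → if c then g (x [ i ]≔ false) else h (x [ i ]≔ false)) (lookup∘update i x false))
                    (ign₁ x false)

  f̂-add : ∀ S → fourier f (add S) ≡ half * (ĝ (drop S) - ĥ (drop S))
  f̂-add S = trans (F̂-add i (λ x → sign (f x)) S)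
    (cong₂ (λ u v → half * (u - v)) (F̂-cong (λ x → cong sign (f-true x)) (drop S))
                                    (F̂-cong (λ x → cong sign (f-false x)) (drop S)))

  f̂-drop : ∀ S → fourier f (drop S) ≡ half * (ĝ (drop S) + ĥ (drop S))
  f̂-drop S = trans (F̂-drop i (λ x → sign (f x)) S)
    (cong₂ (λ u v → half * (u + v)) (F̂-cong (λ x → cong sign (f-true x)) (drop S))
                                    (F̂-cong (λ x → cong sign (f-false x)) (drop S)))

  ĝ-add : ∀ S → ĝ (add S) ≡ 0ℚ
  ĝ-add = F̂-ignoring i (λ x → sign (g x)) (λ x v → cong sign (ign₀ x v))

  ĥ-add : ∀ S → ĥ (add S) ≡ 0ℚ
  ĥ-add = F̂-ignoring i (λ x → sign (h x)) (λ x v → cong sign (ign₁ x v))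

  -- 𝔼[gh], which is 1 − 2 Pr[g ≠ h].
  correlation : ℚ
  correlation = 𝔼 n (λ x → sign (g x) * sign (h x))

  -- Weight of the pair {Z ∪ {i}, Z} in I[f], for Z ∌ i.
  pairInfluence : Subset n → ℚ
  pairInfluence Z = (1ℚ + fromℕ (card Z)) * sq (half * (ĝ Z - ĥ Z)) + fromℕ (card Z) * sq (half * (ĝ Z + ĥ Z))

  influence-pair : ∀ S → influenceTerm f (add S) + influenceTerm f (drop S) ≡ pairInfluence (drop S)
  influence-pair S =
    cong₂ _+_ (cong₂ (λ c u → c * sq u) (trans (cong fromℕ (card-add S i)) (fromℕ-suc (card (drop S)))) (f̂-add S))
              (cong (λ u → fromℕ (card (drop S)) * sq u) (f̂-drop S))

  pairInfluence-add : ∀ S → pairInfluence (add S) ≡ 0ℚ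
  pairInfluence-add S = trans
    (cong₂ (λ u v → (1ℚ + c) * sq (half * (u - v)) + c * sq (half * (u + v))) (ĝ-add S) (ĥ-add S))
    (solve 1 (λ c → (con 1ℚ :+ c) :* ((con half :* (con 0ℚ :- con 0ℚ)) :* (con half :* (con 0ℚ :- con 0ℚ)))
                    :+ c :* ((con half :* (con 0ℚ :+ con 0ℚ)) :* (con half :* (con 0ℚ :+ con 0ℚ))) := con 0ℚ)
           refl c)
    where c = fromℕ (card (add S))

  -- (a − b)²/4 = (a² + b²)/4 − ab/2 separates the weight into influence and correlation parts.
  pairInfluence-expand : ∀ Z → pairInfluence Z ≡ half * (influenceTerm g Z + influenceTerm h Z)
                                                 + half * (half * (sq (ĝ Z) + sq (ĥ Z)) + (- 1ℚ) * (ĝ Z * ĥ Z))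
  pairInfluence-expand Z = solve 3 (λ c a b →
      (con 1ℚ :+ c) :* ((con half :* (a :- b)) :* (con half :* (a :- b))) :+ c :* ((con half :* (a :+ b)) :* (con half :* (a :+ b)))
      := con half :* (c :* (a :* a) :+ c :* (b :* b)) :+ con half :* (con half :* (a :* a :+ b :* b) :+ con (- 1ℚ) :* (a :* b)))
    refl (fromℕ (card Z)) (ĝ Z) (ĥ Z)

  -- I[f] = ½ (I[g] + I[h]) + ½ (1 − 𝔼[gh]): coordinates other than i inherit the average
  -- of their influences in g and h, and x_i has influence Pr[g ≠ h].
  influence-node : influence f ≡ half * (influence g + influence h) + half * (1ℚ - correlation)
  influence-node = begin
      influence f
        ≡⟨ trans (Σ-split i (influenceTerm f)) (cong (half *_) (Σ-cong n influence-pair)) ⟩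
      half * Σ n (λ S → pairInfluence (drop S))
        ≡⟨ trans (Σ-fold i pairInfluence pairInfluence-add) (Σ-cong n pairInfluence-expand) ⟩
      Σ n (λ Z → half * (influenceTerm g Z + influenceTerm h Z) + half * (half * (sq (ĝ Z) + sq (ĥ Z)) + (- 1ℚ) * (ĝ Z * ĥ Z)))
        ≡⟨ Σ-linear n half half _ (λ Z → half * (sq (ĝ Z) + sq (ĥ Z)) + (- 1ℚ) * (ĝ Z * ĥ Z)) ⟩
      half * Σ n (λ Z → influenceTerm g Z + influenceTerm h Z)
        + half * Σ n (λ Z → half * (sq (ĝ Z) + sq (ĥ Z)) + (- 1ℚ) * (ĝ Z * ĥ Z))
        ≡⟨ cong₂ (λ u v → half * u + half * v) (Σ-+ n (influenceTerm g) (influenceTerm h))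
             (trans (Σ-linear n half (- 1ℚ) (λ Z → sq (ĝ Z) + sq (ĥ Z)) (λ Z → ĝ Z * ĥ Z))
                    (cong₂ (λ u v → half * u + (- 1ℚ) * v)
                           (trans (Σ-+ n (λ Z → sq (ĝ Z)) (λ Z → sq (ĥ Z))) (cong₂ _+_ (parseval g) (parseval h)))
                           (plancherel n (λ x → sign (g x)) (λ x → sign (h x))))) ⟩
      half * (influence g + influence h) + half * (half * (1ℚ + 1ℚ) + (- 1ℚ) * correlation)
        ≡⟨ cong (λ z → half * (influence g + influence h) + half * z)
                (solve 1 (λ c → con half :* (con 1ℚ :+ con 1ℚ) :+ con (- 1ℚ) :* c := con 1ℚ :- c) refl correlation) ⟩
      half * (influence g + influence h) + half * (1ℚ - correlation) ∎
    where open ≡-Reasoning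

  -- Step (5) of the protocol on S: the average of the subtree costs on S ∖ {i},
  -- weighted by ĝ(S ∖ {i})² and ĥ(S ∖ {i})².
  average : Subset n → ℚ
  average S = (sq (ĝ (drop S)) * expLen t₀ (drop S) + sq (ĥ (drop S)) * expLen t₁ (drop S))
              ÷₀ (sq (ĝ (drop S)) + sq (ĥ (drop S)))

  -- One round of the protocol at the root: on S ∪ {i} it outputs 1 and then ⊥ or a
  -- branch bit followed by a subtree run; on a nonempty S ∖ {i} it outputs 0, the bit and the run.
  expLen-add : ∀ S → expLen T (add S) ≡ 1ℚ + (if isEmpty (drop S) then 1ℚ else 1ℚ + average S)
  expLen-add S rewrite isEmpty-add S i | []≔-idempotent {x = true} {y = false} S i = refl

  expLen-drop : ∀ S → expLen T (drop S) ≡ (if isEmpty (drop S) then 0ℚ else 1ℚ + (1ℚ + average S))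
  expLen-drop S with isEmpty (drop S) in empty
  ... | true  = refl
  ... | false rewrite []≔-idempotent {x = false} {y = false} S i | empty = refl

  cost : Subset n → ℚ
  cost S = sq (fourier f S) * expLen T S

  atEmpty : Subset n → ℚ
  atEmpty Z = if isEmpty Z then ĝ Z * ĥ Z else 0ℚ

  -- Upper bound for the cost of the pair {Z ∪ {i}, Z}, Z ∌ i.
  pairBound : Subset n → ℚ
  pairBound Z = (sq (ĝ Z) + sq (ĥ Z))
                + ((- two) * atEmpty Z + half * (sq (ĝ Z) * expLen t₀ Z + sq (ĥ Z) * expLen t₁ Z))

  pair-cost : ∀ S → cost (add S) + cost (drop S) ≤ pairBound (drop S)
  pair-cost S = begin
      cost (add S) + cost (drop S)
        ≡⟨ cong₂ _+_ (cong₂ (λ u e → sq u * e) (f̂-add S) (expLen-add S))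
                     (cong₂ (λ u e → sq u * e) (f̂-drop S) (expLen-drop S)) ⟩
      sq (half * (a - b)) * (1ℚ + (if isEmpty (drop S) then 1ℚ else 1ℚ + average S))
        + sq (half * (a + b)) * (if isEmpty (drop S) then 0ℚ else 1ℚ + (1ℚ + average S))
        ≤⟨ pair-cost-bound (isEmpty (drop S)) a b (average S) (expLen t₀ (drop S)) (expLen t₁ (drop S))
             (expLen-empty t₀ (drop S)) (expLen-empty t₁ (drop S))
             (weighted-average (sq a) (sq b) (expLen t₀ (drop S)) (expLen t₁ (drop S)) (sq-nonneg a) (sq-nonneg b)) ⟩
      pairBound (drop S) ∎
    where
    open ℚ.≤-Reasoning
    a = ĝ (drop S)
    b = ĥ (drop S)

  pairBound-add : ∀ S → pairBound (add S) ≡ 0ℚ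
  pairBound-add S = begin
      pairBound (add S)
        ≡⟨ cong₂ (λ c u → u + ((- two) * c + half * (sq (ĝ (add S)) * e₀ + sq (ĥ (add S)) * e₁)))
                 (cong (λ empty → if empty then ĝ (add S) * ĥ (add S) else 0ℚ) (isEmpty-add S i))
                 (cong₂ (λ a b → sq a + sq b) (ĝ-add S) (ĥ-add S)) ⟩
      (sq 0ℚ + sq 0ℚ) + ((- two) * 0ℚ + half * (sq (ĝ (add S)) * e₀ + sq (ĥ (add S)) * e₁))
        ≡⟨ cong₂ (λ a b → (sq 0ℚ + sq 0ℚ) + ((- two) * 0ℚ + half * (sq a * e₀ + sq b * e₁))) (ĝ-add S) (ĥ-add S) ⟩
      (sq 0ℚ + sq 0ℚ) + ((- two) * 0ℚ + half * (sq 0ℚ * e₀ + sq 0ℚ * e₁))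
        ≡⟨ solve 2 (λ e e′ → (con 0ℚ :* con 0ℚ :+ con 0ℚ :* con 0ℚ)
                            :+ (con (- two) :* con 0ℚ :+ con half :* (con 0ℚ :* con 0ℚ :* e :+ con 0ℚ :* con 0ℚ :* e′))
                            := con 0ℚ) refl e₀ e₁ ⟩
      0ℚ ∎
    where
    open ≡-Reasoning
    e₀ = expLen t₀ (add S)
    e₁ = expLen t₁ (add S)

  meanProduct : ℚ
  meanProduct = ĝ (emptySet n) * ĥ (emptySet n)

  protocol-node : expLenProtocol T ≤ two * (1ℚ - meanProduct) + half * (expLenProtocol t₀ + expLenProtocol t₁)
  protocol-node = begin
      expLenProtocol T
        ≡⟨ Σ-split i cost ⟩
      half * Σ n (λ S → cost (add S) + cost (drop S))
        ≤⟨ ℚ.*-monoˡ-≤-nonNeg half (Σ-mono n pair-cost) ⟩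
      half * Σ n (λ S → pairBound (drop S))
        ≡⟨ Σ-fold i pairBound pairBound-add ⟩
      Σ n pairBound
        ≡⟨ trans (Σ-+ n _ _)
             (cong₂ _+_ (trans (Σ-+ n (λ Z → sq (ĝ Z)) (λ Z → sq (ĥ Z))) (cong₂ _+_ (parseval g) (parseval h)))
                        (trans (Σ-linear n (- two) half atEmpty _)
                               (cong₂ (λ u v → (- two) * u + half * v)
                                      (Σ-at-empty n (λ Z → ĝ Z * ĥ Z))
                                      (Σ-+ n (λ Z → sq (ĝ Z) * expLen t₀ Z) (λ Z → sq (ĥ Z) * expLen t₁ Z))))) ⟩
      (1ℚ + 1ℚ) + ((- two) * meanProduct + half * (expLenProtocol t₀ + expLenProtocol t₁))
        ≡⟨ solve 2 (λ m e → (con 1ℚ :+ con 1ℚ) :+ (con (- two) :* m :+ con half :* e)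
                            := con two :* (con 1ℚ :- m) :+ con half :* e) refl
             meanProduct (expLenProtocol t₀ + expLenProtocol t₁) ⟩
      two * (1ℚ - meanProduct) + half * (expLenProtocol t₀ + expLenProtocol t₁) ∎
    where open ℚ.≤-Reasoning

  lengthBound-node : lengthBound T ≡ two * (1ℚ - meanProduct) + half * (lengthBound t₀ + lengthBound t₁)
  lengthBound-node = begin
      four * influence f + two * treeCov T
        ≡⟨ cong₂ (λ u v → four * u + two * v) influence-node
                 (trans (treeCov-node i t₀ t₁) (cong (_+ half * (treeCov t₀ + treeCov t₁)) (cov-expand g h))) ⟩
      four * (half * (influence g + influence h) + half * (1ℚ - correlation))
        + two * ((correlation - meanProduct) + half * (treeCov t₀ + treeCov t₁))
        ≡⟨ solve 6 (λ Ig Ih e m C₀ C₁ →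
              con four :* (con half :* (Ig :+ Ih) :+ con half :* (con 1ℚ :- e)) :+ con two :* ((e :- m) :+ con half :* (C₀ :+ C₁))
              := con two :* (con 1ℚ :- m) :+ con half :* ((con four :* Ig :+ con two :* C₀) :+ (con four :* Ih :+ con two :* C₁)))
             refl (influence g) (influence h) correlation meanProduct (treeCov t₀) (treeCov t₁) ⟩
      two * (1ℚ - meanProduct) + half * (lengthBound t₀ + lengthBound t₁) ∎
    where open ≡-Reasoning

  node-bound : expLenProtocol t₀ ≤ lengthBound t₀ → expLenProtocol t₁ ≤ lengthBound t₁ →
               expLenProtocol T ≤ lengthBound T
  node-bound bound₀ bound₁ = begin
      expLenProtocol T
        ≤⟨ protocol-node ⟩
      two * (1ℚ - meanProduct) + half * (expLenProtocol t₀ + expLenProtocol t₁)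
        ≤⟨ ℚ.+-monoʳ-≤ (two * (1ℚ - meanProduct)) (ℚ.*-monoˡ-≤-nonNeg half (ℚ.+-mono-≤ bound₀ bound₁)) ⟩
      two * (1ℚ - meanProduct) + half * (lengthBound t₀ + lengthBound t₁)
        ≡⟨ sym lengthBound-node ⟩
      lengthBound T ∎
    where open ℚ.≤-Reasoning

leaf-bound : ∀ {n} (b : Bool) → expLenProtocol (leaf {n} b) ≤ lengthBound (leaf {n} b)
leaf-bound {n} b = begin
    expLenProtocol L
      ≡⟨ trans (Σ-cong n (λ S → trans (cong (sq (fourier (eval L) S) *_) (stops S)) (ℚ.*-zeroʳ (sq (fourier (eval L) S)))))
               (Σ-zero n) ⟩
    0ℚ
      ≤⟨ *-nonneg (fromℕ-nonneg 4) (influence-nonneg (eval L)) ⟩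
    four * influence (eval L)
      ≡⟨ solve 1 (λ I → con four :* I := con four :* I :+ con two :* con 0ℚ) refl (influence (eval L)) ⟩
    lengthBound L ∎
  where
  open ℚ.≤-Reasoning
  L : DT n
  L = leaf b
  stops : ∀ S → expLen L S ≡ 0ℚ
  stops S with isEmpty S
  ... | true  = refl
  ... | false = refl

-- Induction on the validity derivation; the queried variable joins U, so the subtrees ignore it.
protocol-bound : ∀ {n U} {T : DT n} → ValidFrom U T → expLenProtocol T ≤ lengthBound T
protocol-bound {n} (leafV {b = b}) = leaf-bound {n} b
protocol-bound {U = U} (nodeV {i = i} {t₀} {t₁} _ valid₀ valid₁) =
  Node.node-bound i t₀ t₁
    (ignores-used valid₀ (lookup∘update i U true)) (ignores-used valid₁ (lookup∘update i U true))
    (protocol-bound valid₀) (protocol-bound valid₁)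

lemma1p7 : (n : ℕ) (T : DT n) → ValidDT T →
    expLenProtocol T ≤ (+ 4 / 1) * influence (eval T) + (+ 2 / 1) * treeCov T
lemma1p7 n T valid = protocol-bound valid
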